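{- Let $\mathbb S$ be a semiring, $A$ a finite alphabet, $n_1,n_2\in\mathbb N$, and let $(\mathbb S^{n_1},c_1)$, $(\mathbb S^{n_2},c_2)$ be $F_{\mathbb S}$-coalgebras. Let $x_1\in\mathbb S^{n_1}$, $x_2\in\mathbb S^{n_2}$ satisfy $\mathrm{tr}_{c_1}x_1=\mathrm{tr}_{c_2}x_2$. For $j=1,2$ define $d_j\colon\mathbb S^{n_1}\times\mathbb S^{n_2}\to F_{\mathbb S}(\mathbb S^{n_1}\times\mathbb S^{n_2})$ by $d_j(y_1,y_2)=\big((c_j)_o(y_j),\ ((c_1)_a(y_1),(c_2)_a(y_2))_{a\in A}\big)$. Let $Z$ be the subsemimodule of $\mathbb S^{n_1}\times\mathbb S^{n_2}$ generated by the pairs $((c_1)_w(x_1),(c_2)_w(x_2))$, $w\in A^*$. Then $d_1|_Z=d_2|_Z$ and $d_j(Z)\subseteq F_{\mathbb S}(Z)$.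
   Context: $F_{\mathbb S}$ is the cubic functor on $\mathbb S$-semimodules: $F_{\mathbb S}X=\mathbb S\times X^A$, $F_{\mathbb S}f=\mathrm{id}_{\mathbb S}\times(f\circ-)$; an $F_{\mathbb S}$-coalgebra is an $\mathbb S$-semimodule $X$ with a semimodule map $c\colon X\to\mathbb S\times X^A$, written $c(x)=(c_o(x),(c_a(x))_{a\in A})$. Set $c_\varepsilon=\mathrm{id}_X$, $c_{wa}=c_a\circ c_w$ for $w\in A^*$, $a\in A$. The trace is $\mathrm{tr}_c(x)=(c_o(c_w(x)))_{w\in A^*}$. -}

module Defs where

open import Level using (Level; _⊔_)
open import Algebra.Bundles using (Semiring)
open import Data.Nat using (ℕ)
open import Data.Fin using (Fin)
open import Data.List using (List; []; _∷_)
open import Data.Product using (_×_; _,_; proj₁; proj₂)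

module _ {c ℓ : Level} (S : Semiring c ℓ) where
  open Semiring S

  Vec : ℕ → Set c
  Vec n = Fin n → Carrier

  _≋_ : {n : ℕ} → Vec n → Vec n → Set ℓ
  x ≋ y = ∀ i → x i ≈ y i

  _⊕_ : {n : ℕ} → Vec n → Vec n → Vec n
  (x ⊕ y) i = x i + y i

  𝟘 : {n : ℕ} → Vec n
  𝟘 i = 0#

  _⊛_ : {n : ℕ} → Carrier → Vec n → Vec n
  (s ⊛ x) i = s * x i

  -- An F_S-coalgebra on S^n over the alphabet Fin m: a semimodule map
  -- c : S^n → S × (S^n)^A, given by its components c_o and c_a (a ∈ A),
  -- each of which is a semimodule map.
  record Coalg (m n : ℕ) : Set (c ⊔ ℓ) where
    field
      out : Vec n → Carrier
      δ   : Fin m → Vec n → Vec n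
      out-cong : ∀ {x y} → x ≋ y → out x ≈ out y
      out-⊕    : ∀ x y → out (x ⊕ y) ≈ out x + out y
      out-𝟘    : out 𝟘 ≈ 0#
      out-⊛    : ∀ s x → out (s ⊛ x) ≈ s * out x
      δ-cong   : ∀ a {x y} → x ≋ y → δ a x ≋ δ a y
      δ-⊕      : ∀ a x y → δ a (x ⊕ y) ≋ (δ a x ⊕ δ a y)
      δ-𝟘      : ∀ a → δ a 𝟘 ≋ 𝟘
      δ-⊛      : ∀ a s x → δ a (s ⊛ x) ≋ (s ⊛ δ a x)

    -- c_w for a word w ∈ A*, with c_ε = id and c_{wa} = c_a ∘ c_w
    -- (a word is a list of letters, read left to right).
    run : List (Fin m) → Vec n → Vec n
    run []      x = x
    run (a ∷ w) x = run w (δ a x)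

    tr : Vec n → List (Fin m) → Carrier
    tr x w = out (run w x)

  open Coalg

  TrEq : {m n₁ n₂ : ℕ} → Coalg m n₁ → Vec n₁ → Coalg m n₂ → Vec n₂ → Set ℓ
  TrEq c₁ x₁ c₂ x₂ = ∀ w → tr c₁ x₁ w ≈ tr c₂ x₂ w

  Pair : ℕ → ℕ → Set c
  Pair n₁ n₂ = Vec n₁ × Vec n₂

  _≋₂_ : {n₁ n₂ : ℕ} → Pair n₁ n₂ → Pair n₁ n₂ → Set ℓ
  (x₁ , x₂) ≋₂ (y₁ , y₂) = (x₁ ≋ y₁) × (x₂ ≋ y₂)

  FPair : ℕ → ℕ → ℕ → Set c
  FPair m n₁ n₂ = Carrier × (Fin m → Pair n₁ n₂)

  _≋F_ : {m n₁ n₂ : ℕ} → FPair m n₁ n₂ → FPair m n₁ n₂ → Set ℓ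
  (o , t) ≋F (o′ , t′) = (o ≈ o′) × (∀ a → t a ≋₂ t′ a)

  d₁ : {m n₁ n₂ : ℕ} → Coalg m n₁ → Coalg m n₂ → Pair n₁ n₂ → FPair m n₁ n₂
  d₁ c₁ c₂ (y₁ , y₂) = out c₁ y₁ , λ a → (δ c₁ a y₁ , δ c₂ a y₂)

  d₂ : {m n₁ n₂ : ℕ} → Coalg m n₁ → Coalg m n₂ → Pair n₁ n₂ → FPair m n₁ n₂
  d₂ c₁ c₂ (y₁ , y₂) = out c₂ y₂ , λ a → (δ c₁ a y₁ , δ c₂ a y₂)

  data InZ {m n₁ n₂ : ℕ} (c₁ : Coalg m n₁) (c₂ : Coalg m n₂)
           (x₁ : Vec n₁) (x₂ : Vec n₂) : Pair n₁ n₂ → Set (c ⊔ ℓ) where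
    gen  : ∀ w → InZ c₁ c₂ x₁ x₂ (run c₁ w x₁ , run c₂ w x₂)
    zer  : InZ c₁ c₂ x₁ x₂ (𝟘 , 𝟘)
    add  : ∀ {y₁ y₂ z₁ z₂} → InZ c₁ c₂ x₁ x₂ (y₁ , y₂) → InZ c₁ c₂ x₁ x₂ (z₁ , z₂)
         → InZ c₁ c₂ x₁ x₂ (y₁ ⊕ z₁ , y₂ ⊕ z₂)
    scal : ∀ s {y₁ y₂} → InZ c₁ c₂ x₁ x₂ (y₁ , y₂) → InZ c₁ c₂ x₁ x₂ (s ⊛ y₁ , s ⊛ y₂)
    resp : ∀ {y z} → y ≋₂ z → InZ c₁ c₂ x₁ x₂ y → InZ c₁ c₂ x₁ x₂ z

  InFZ : {m n₁ n₂ : ℕ} (c₁ : Coalg m n₁) (c₂ : Coalg m n₂) (x₁ : Vec n₁) (x₂ : Vec n₂)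
       → FPair m n₁ n₂ → Set (c ⊔ ℓ)
  InFZ c₁ c₂ x₁ x₂ (o , t) = ∀ a → InZ c₁ c₂ x₁ x₂ (t a)

module Submission where

open import Defs
open import Level using (Level; _⊔_)
open import Algebra.Bundles using (Semiring)
open import Data.Nat using (ℕ)
open import Data.List using ([]; _∷_; _∷ʳ_)
open import Data.Product using (_×_; _,_)
open import Relation.Binary.PropositionalEquality as ≡ using (_≡_; subst; cong₂)

-- Z is spanned by the pairs (c₁_w x₁ , c₂_w x₂); a letter a sends such a generator to the
-- generator for w a, and both c_a are linear, so Z is closed under the transitions.
-- Equal traces say that c₁_o and c₂_o agree on the generators, hence, by linearity, on Z;
-- this is all that distinguishes d₁ from d₂.

module _ {c ℓ : Level} (S : Semiring c ℓ) where
  open Semiring S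
  open Coalg
  open import Relation.Binary.Reasoning.Setoid setoid

  run-∷ʳ : ∀ {m n} (k : Coalg S m n) w a x → run k (w ∷ʳ a) x ≡ δ k a (run k w x)
  run-∷ʳ k []      a x = ≡.refl
  run-∷ʳ k (b ∷ w) a x = run-∷ʳ k w a (δ k b x)

  ≋-refl : ∀ {n} {x : Vec S n} → _≋_ S x x
  ≋-refl i = refl

  ≋-sym : ∀ {n} {x y : Vec S n} → _≋_ S x y → _≋_ S y x
  ≋-sym x≋y i = sym (x≋y i)

  module _ {m n₁ n₂ : ℕ} (c₁ : Coalg S m n₁) (c₂ : Coalg S m n₂)
           (x₁ : Vec S n₁) (x₂ : Vec S n₂) where

    Z : Pair S n₁ n₂ → Set (c ⊔ ℓ)
    Z = InZ S c₁ c₂ x₁ x₂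

    Z-closed-δ : ∀ a {y₁ y₂} → Z (y₁ , y₂) → Z (δ c₁ a y₁ , δ c₂ a y₂)
    Z-closed-δ a (gen w) =
      subst Z (cong₂ _,_ (run-∷ʳ c₁ w a x₁) (run-∷ʳ c₂ w a x₂)) (gen (w ∷ʳ a))
    Z-closed-δ a zer =
      resp (≋-sym (δ-𝟘 c₁ a) , ≋-sym (δ-𝟘 c₂ a)) zer
    Z-closed-δ a (add {y₁} {y₂} {z₁} {z₂} y∈Z z∈Z) =
      resp (≋-sym (δ-⊕ c₁ a y₁ z₁) , ≋-sym (δ-⊕ c₂ a y₂ z₂))
           (add (Z-closed-δ a y∈Z) (Z-closed-δ a z∈Z))
    Z-closed-δ a (scal s {y₁} {y₂} y∈Z) =
      resp (≋-sym (δ-⊛ c₁ a s y₁) , ≋-sym (δ-⊛ c₂ a s y₂)) (scal s (Z-closed-δ a y∈Z))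
    Z-closed-δ a (resp {y₁ , y₂} {z₁ , z₂} (y₁≋z₁ , y₂≋z₂) y∈Z) =
      resp (δ-cong c₁ a y₁≋z₁ , δ-cong c₂ a y₂≋z₂) (Z-closed-δ a y∈Z)

    out-agree-on-Z : TrEq S c₁ x₁ c₂ x₂ → ∀ {y₁ y₂} → Z (y₁ , y₂) → out c₁ y₁ ≈ out c₂ y₂
    out-agree-on-Z tr≈ (gen w) = tr≈ w
    out-agree-on-Z tr≈ zer = begin
      out c₁ (𝟘 S) ≈⟨ out-𝟘 c₁ ⟩
      0#           ≈⟨ out-𝟘 c₂ ⟨
      out c₂ (𝟘 S) ∎
    out-agree-on-Z tr≈ (add {y₁} {y₂} {z₁} {z₂} y∈Z z∈Z) = begin
      out c₁ (_⊕_ S y₁ z₁)      ≈⟨ out-⊕ c₁ y₁ z₁ ⟩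
      out c₁ y₁ + out c₁ z₁     ≈⟨ +-cong (out-agree-on-Z tr≈ y∈Z) (out-agree-on-Z tr≈ z∈Z) ⟩
      out c₂ y₂ + out c₂ z₂     ≈⟨ out-⊕ c₂ y₂ z₂ ⟨
      out c₂ (_⊕_ S y₂ z₂)      ∎
    out-agree-on-Z tr≈ (scal s {y₁} {y₂} y∈Z) = begin
      out c₁ (_⊛_ S s y₁)       ≈⟨ out-⊛ c₁ s y₁ ⟩
      s * out c₁ y₁             ≈⟨ *-congˡ (out-agree-on-Z tr≈ y∈Z) ⟩
      s * out c₂ y₂             ≈⟨ out-⊛ c₂ s y₂ ⟨
      out c₂ (_⊛_ S s y₂)       ∎
    out-agree-on-Z tr≈ (resp {y₁ , y₂} {z₁ , z₂} (y₁≋z₁ , y₂≋z₂) y∈Z) = begin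
      out c₁ z₁                 ≈⟨ out-cong c₁ y₁≋z₁ ⟨
      out c₁ y₁                 ≈⟨ out-agree-on-Z tr≈ y∈Z ⟩
      out c₂ y₂                 ≈⟨ out-cong c₂ y₂≋z₂ ⟩
      out c₂ z₂                 ∎

lemma4 : {c ℓ : Level} (S : Semiring c ℓ) (m n₁ n₂ : ℕ)
           (c₁ : Coalg S m n₁) (c₂ : Coalg S m n₂)
           (x₁ : Vec S n₁) (x₂ : Vec S n₂)
         → TrEq S c₁ x₁ c₂ x₂
         → (∀ y → InZ S c₁ c₂ x₁ x₂ y → _≋F_ S (d₁ S c₁ c₂ y) (d₂ S c₁ c₂ y))
           × (∀ y → InZ S c₁ c₂ x₁ x₂ y → InFZ S c₁ c₂ x₁ x₂ (d₁ S c₁ c₂ y))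
           × (∀ y → InZ S c₁ c₂ x₁ x₂ y → InFZ S c₁ c₂ x₁ x₂ (d₂ S c₁ c₂ y))
lemma4 S m n₁ n₂ c₁ c₂ x₁ x₂ tr≈ =
  (λ { (y₁ , y₂) y∈Z → out-agree-on-Z S c₁ c₂ x₁ x₂ tr≈ y∈Z , λ a → ≋-refl S , ≋-refl S }) ,
  (λ { (y₁ , y₂) y∈Z a → Z-closed-δ S c₁ c₂ x₁ x₂ a y∈Z }) ,
  (λ { (y₁ , y₂) y∈Z a → Z-closed-δ S c₁ c₂ x₁ x₂ a y∈Z })
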